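{- Let $G$ be a finite connected graph and let $x \in V(G)$. Then $\partial(x)$ is the unique $x$-geodominating set of minimum cardinality (the unique $g_x$-set) of $G$, and $g_x(G) = |\partial(x)|$.
   Context: Graphs are simple. $d(u,v)$ denotes the shortest-path distance in $G$ and $N(v)$ the set of neighbours of $v$. The interval $I[u,v]$ is the set of vertices lying on some shortest $u$–$v$ path (geodesic). A vertex $y$ $x$-geodominates a vertex $u$ if $u \in I[x,y]$. A set $S \subseteq V(G)$ is $x$-geodominating if every vertex of $G$ is $x$-geodominated by some element of $S$. The $x$-geodomination number $g_x(G)$ is the minimum cardinality of an $x$-geodominating set, and an $x$-geodominating set of cardinality $g_x(G)$ is a $g_x$-set. The boundary of $x$ is $\partial(x) = \{ v \in V(G) : d(x,w) \le d(x,v) \text{ for all } w \in N(v)\}$. -}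

module Defs where

open import Data.Nat using (ℕ; zero; suc; _≤_)
open import Data.Fin using (Fin)
open import Data.Fin.Subset using (Subset; _∈_; ∣_∣)
open import Data.Product using (Σ; ∃; _×_; _,_)
open import Relation.Nullary using (¬_; Dec)
open import Relation.Binary.PropositionalEquality using (_≡_)
open import Function.Bundles using (_⇔_)

record Graph (n : ℕ) : Set₁ where
  field
    Adj    : Fin n → Fin n → Set
    adj?   : ∀ u v → Dec (Adj u v)
    sym    : ∀ {u v} → Adj u v → Adj v u
    irrefl : ∀ {u} → ¬ Adj u u

module _ {n : ℕ} (G : Graph n) where
  open Graph G

  data Walk : Fin n → Fin n → ℕ → Set where
    here : ∀ {u} → Walk u u zero
    step : ∀ {u w v k} → Adj u w → Walk w v k → Walk u v (suc k)

  data OnWalk (z : Fin n) : ∀ {u v k} → Walk u v k → Set where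
    on-here  : OnWalk z {z} {z} here
    on-start : ∀ {w v k} (e : Adj z w) (p : Walk w v k) → OnWalk z (step e p)
    on-later : ∀ {u w v k} (e : Adj u w) (p : Walk w v k) →
               OnWalk z p → OnWalk z (step e p)

  Connected : Set
  Connected = ∀ u v → ∃ λ k → Walk u v k

  Dist : Fin n → Fin n → ℕ → Set
  Dist u v k = Walk u v k × (∀ m → Walk u v m → k ≤ m)

  InInterval : Fin n → Fin n → Fin n → Set
  InInterval x y u = Σ ℕ λ k → Dist x y k × Σ (Walk x y k) λ p → OnWalk u p

  Geodominates : Fin n → Fin n → Fin n → Set
  Geodominates x y u = InInterval x y u

  IsGeodominating : Fin n → Subset n → Set
  IsGeodominating x S = ∀ u → Σ (Fin n) λ y → y ∈ S × Geodominates x y u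

  IsGxSet : Fin n → Subset n → Set
  IsGxSet x S = IsGeodominating x S × (∀ T → IsGeodominating x T → ∣ S ∣ ≤ ∣ T ∣)

  IsGxNumber : Fin n → ℕ → Set
  IsGxNumber x k =
    (Σ (Subset n) λ S → IsGeodominating x S × ∣ S ∣ ≡ k) ×
    (∀ T → IsGeodominating x T → k ≤ ∣ T ∣)

  InBoundary : Fin n → Fin n → Set
  InBoundary x v = ∀ w → Adj v w → ∀ dw dv → Dist x w dw → Dist x v dv → dw ≤ dv

  IsBoundary : Fin n → Subset n → Set
  IsBoundary x B = ∀ v → (v ∈ B) ⇔ InBoundary x v

-- A vertex v of ∂(x) lying on a geodesic from x to y is y itself: otherwise the
-- geodesic continues to a neighbour w with d(x,w) ≤ d(x,v), and a shortest x–w path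
-- followed by the rest of the geodesic would be shorter. So every x-geodominating set
-- contains ∂(x). Conversely, a geodesic from x whose endpoint is not in ∂(x) extends by
-- an edge to a neighbour farther from x; as distances are bounded this stops at a vertex
-- of ∂(x), so ∂(x) is itself x-geodominating, and hence the unique minimum one.
module Submission where

open import Defs
open import Data.Nat using (ℕ; zero; suc; _+_; _≤_; _<_; z≤n; s≤s⁻¹; _≤?_)
open import Data.Nat.Properties
  using (≤-refl; ≤-trans; ≤-antisym; ≮⇒≥; m≤n⇒m<n∨m≡n; <-≤-trans;
         n≮n; <⇒≱; ≰⇒>; n<1+n; +-monoʳ-<; module ≤-Reasoning; +-suc; +-monoˡ-≤; m≤m+n)
open import Data.Fin using (Fin)
open import Data.Fin.Properties using (any?; all?; ¬∀⟶∃¬) renaming (_≟_ to _≟ᶠ_)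
open import Data.Fin.Subset using (Subset; ∣_∣; _∈_; _⊆_)
open import Data.Fin.Subset.Properties using (_∈?_; ⊆-antisym; p⊆q⇒∣p∣≤∣q∣; p⊂q⇒∣p∣<∣q∣)
open import Data.Vec using (tabulate)
open import Data.Vec.Properties using (lookup∘tabulate; []=⇒lookup; lookup⇒[]=)
open import Data.List.Extrema.Nat using (max; xs≤max)
open import Data.List.Relation.Unary.All.Properties using (tabulate⁻)
open import Data.Product using (Σ; ∃; ∃₂; _×_; _,_; proj₁; proj₂)
open import Data.Sum using (_⊎_; inj₁; inj₂)
open import Function using (_∘_)
open import Relation.Nullary using (¬_; Dec; yes; no; does; contradiction)
open import Relation.Nullary.Decidable using (map′; dec-true; _×-dec_; _→-dec_)
open import Relation.Unary using (Decidable)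
open import Relation.Binary.PropositionalEquality using (_≡_; refl; sym; trans; subst; subst₂)
open import Function.Bundles using (mk⇔; Equivalence)
import Data.List as List

Least : (ℕ → Set) → ℕ → Set
Least P m = P m × (∀ k → P k → m ≤ k)

least-upTo : ∀ {P : ℕ → Set} → Decidable P → ∀ k → ∃ (Least P) ⊎ (∀ m → m ≤ k → ¬ P m)
least-upTo P? zero with P? zero
... | yes p = inj₁ (zero , p , λ _ _ → z≤n)
... | no ¬p = inj₂ λ { .zero z≤n → ¬p }
least-upTo {P = P} P? (suc k) with least-upTo P? k
... | inj₁ m = inj₁ m
... | inj₂ none with P? (suc k)
...   | yes p = inj₁ (suc k , p , λ m pm → ≮⇒≥ λ m<1+k → none m (s≤s⁻¹ m<1+k) pm)
...   | no ¬p = inj₂ λ m m≤1+k → none′ (m≤n⇒m<n∨m≡n m≤1+k)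
  where
  none′ : ∀ {m} → m < suc k ⊎ m ≡ suc k → ¬ P m
  none′ (inj₁ m<1+k) = none _ (s≤s⁻¹ m<1+k)
  none′ (inj₂ refl) = ¬p

least : ∀ {P : ℕ → Set} → Decidable P → ∀ {k} → P k → ∃ (Least P)
least P? {k} pk with least-upTo P? k
... | inj₁ m = m
... | inj₂ none = contradiction pk (none k ≤-refl)

subset : ∀ {n} {P : Fin n → Set} → Decidable P → Subset n
subset P? = tabulate (does ∘ P?)

module _ {n} {P : Fin n → Set} (P? : Decidable P) where

  ∈-subset⁺ : ∀ {i} → P i → i ∈ subset P?
  ∈-subset⁺ {i} pi = lookup⇒[]= i _ (trans (lookup∘tabulate (does ∘ P?) i) (dec-true (P? i) pi))

  ∈-subset⁻ : ∀ {i} → i ∈ subset P? → P i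
  ∈-subset⁻ {i} i∈ with P? i | trans (sym (lookup∘tabulate (does ∘ P?) i)) ([]=⇒lookup i∈)
  ... | yes pi | _ = pi
  ... | no _   | ()

⊆∧∣∣≤⇒≡ : ∀ {n} {p q : Subset n} → p ⊆ q → ∣ q ∣ ≤ ∣ p ∣ → q ≡ p
⊆∧∣∣≤⇒≡ {p = p} {q} p⊆q ∣q∣≤∣p∣ = ⊆-antisym q⊆p p⊆q
  where
  q⊆p : q ⊆ p
  q⊆p {i} i∈q with i ∈? p
  ... | yes i∈p = i∈p
  ... | no i∉p = contradiction ∣q∣≤∣p∣ (<⇒≱ (p⊂q⇒∣p∣<∣q∣ (p⊆q , i , i∈q , i∉p)))

bounded : ∀ {n} (f : Fin n → ℕ) → ∃ λ M → ∀ i → f i ≤ M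
bounded f = max 0 (List.tabulate f) , tabulate⁻ (xs≤max 0 (List.tabulate f))

module _ {n} (G : Graph n) where
  open Graph G using (Adj; adj?)

  walk? : ∀ k u v → Dec (Walk G u v k)
  walk? zero u v with u ≟ᶠ v
  ... | yes refl = yes here
  ... | no u≢v = no λ { here → u≢v refl }
  walk? (suc k) u v =
    map′ (λ (_ , e , p) → step e p) (λ { (step e p) → _ , e , p })
         (any? λ w → adj? u w ×-dec walk? k w v)

  _++ʷ_ : ∀ {u v w a b} → Walk G u v a → Walk G v w b → Walk G u w (a + b)
  here     ++ʷ q = q
  step e p ++ʷ q = step e (p ++ʷ q)

  _▷_ : ∀ {u v w k} → Walk G u v k → Adj v w → Walk G u w (suc k)
  here     ▷ e = step e here
  step e p ▷ f = step e (p ▷ f)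

  onWalk-end : ∀ {u v k} (p : Walk G u v k) → OnWalk G v p
  onWalk-end here       = on-here
  onWalk-end (step e p) = on-later e p (onWalk-end p)

  onWalk-▷ : ∀ {z u v w k} {p : Walk G u v k} (e : Adj v w) → OnWalk G z p → OnWalk G z (p ▷ e)
  onWalk-▷ e on-here            = on-start e here
  onWalk-▷ e (on-start f p)     = on-start f (p ▷ e)
  onWalk-▷ e (on-later f p z∈p) = on-later f (p ▷ e) (onWalk-▷ e z∈p)

  split : ∀ {z u v k} (p : Walk G u v k) → OnWalk G z p →
          ∃₂ λ a b → Walk G u z a × Walk G z v b × a + b ≡ k
  split here on-here = 0 , 0 , here , here , refl
  split (step e p) (on-start e p) = 0 , _ , here , step e p , refl
  split (step e p) (on-later e p z∈p) with split p z∈p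
  ... | a , b , p₁ , p₂ , refl = suc a , b , step e p₁ , p₂ , refl

  dist : ∀ {u v k} → Walk G u v k → ∃ (Dist G u v)
  dist {u} {v} p = least (λ k → walk? k u v) p

  Dist-unique : ∀ {u v a b} → Dist G u v a → Dist G u v b → a ≡ b
  Dist-unique (p , a-min) (q , b-min) = ≤-antisym (a-min _ q) (b-min _ p)

  boundary-on-geodesic⇒endpoint : ∀ {x v y k} → InBoundary G x v → Dist G x y k →
                             (p : Walk G x y k) → OnWalk G v p → v ≡ y
  boundary-on-geodesic⇒endpoint {x} {v} ∂v (_ , k-min) p v∈p with split p v∈p
  ... | a , zero  , _  , here , _ = refl
  ... | a , suc b , p₁ , step {w = w} e q , refl = contradiction a+b<a+b (n≮n (a + b))
    where
    dv dw : ℕ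
    dv = proj₁ (dist p₁)
    dw = proj₁ (dist (p₁ ▷ e))

    Dv : Dist G x v dv
    Dv = proj₂ (dist p₁)

    Dw : Dist G x w dw
    Dw = proj₂ (dist (p₁ ▷ e))

    open ≤-Reasoning
    a+b<a+b : a + b < a + b
    a+b<a+b = begin-strict
      a + b     <⟨ +-monoʳ-< a (n<1+n b) ⟩
      a + suc b ≤⟨ k-min _ (proj₁ Dw ++ʷ q) ⟩
      dw + b    ≤⟨ +-monoˡ-≤ b (≤-trans (∂v w e dw dv Dw Dv) (proj₂ Dv a p₁)) ⟩
      a + b     ∎

  boundary⊆geodominating : ∀ {x B S} → IsBoundary G x B → IsGeodominating G x S → B ⊆ S
  boundary⊆geodominating {S = S} isB geoS {v} v∈B with geoS v
  ... | y , y∈S , _ , D , p , v∈p =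
    subst (_∈ S) (sym (boundary-on-geodesic⇒endpoint (Equivalence.to (isB v) v∈B) D p v∈p)) y∈S

  module Boundary (connected : Connected G) (x : Fin n) where

    d : Fin n → ℕ
    d v = proj₁ (dist (proj₂ (connected x v)))

    d-Dist : ∀ v → Dist G x v (d v)
    d-Dist v = proj₂ (dist (proj₂ (connected x v)))

    InBoundary⇒neighbours-nearer : ∀ {v} → InBoundary G x v → ∀ w → Adj v w → d w ≤ d v
    InBoundary⇒neighbours-nearer {v} ∂v w e = ∂v w e _ _ (d-Dist w) (d-Dist v)

    neighbours-nearer⇒InBoundary : ∀ {v} → (∀ w → Adj v w → d w ≤ d v) → InBoundary G x v
    neighbours-nearer⇒InBoundary {v} nearer w e _ _ Dw Dv =
      subst₂ _≤_ (Dist-unique (d-Dist w) Dw) (Dist-unique (d-Dist v) Dv) (nearer w e)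

    ∂? : Decidable (InBoundary G x)
    ∂? v = map′ neighbours-nearer⇒InBoundary InBoundary⇒neighbours-nearer
                (all? λ w → adj? v w →-dec d w ≤? d v)

    ∂ : Subset n
    ∂ = subset ∂?

    ∂-IsBoundary : IsBoundary G x ∂
    ∂-IsBoundary v = mk⇔ (∈-subset⁻ ∂?) (∈-subset⁺ ∂?)

    farther-neighbour : ∀ {y} → ¬ InBoundary G x y → ∃ λ w → Adj y w × d y < d w
    farther-neighbour {y} ¬∂y
      with ¬∀⟶∃¬ n _ (λ w → adj? y w →-dec d w ≤? d y) (¬∂y ∘ neighbours-nearer⇒InBoundary)
    ... | w , ¬nearer with adj? y w
    ...   | yes e = w , e , ≰⇒> (λ dw≤dy → ¬nearer λ _ → dw≤dy)
    ...   | no ¬e = contradiction (λ e → contradiction e ¬e) ¬nearer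

    geodesic-▷ : ∀ {y w k} → Dist G x y k → Adj y w → k < d w → Dist G x w (suc k)
    geodesic-▷ {w = w} (p , _) e k<dw = p ▷ e , λ m q → ≤-trans k<dw (proj₂ (d-Dist w) m q)

    private
      M : ℕ
      M = proj₁ (bounded d)

      d≤M : ∀ v → d v ≤ M
      d≤M = proj₂ (bounded d)

    -- Recursion on the fuel f: each extension raises k, and k < d w ≤ M.
    climb : ∀ f {u y k} → M ≤ f + k → Dist G x y k → (p : Walk G x y k) → OnWalk G u p →
            ∃ λ y′ → y′ ∈ ∂ × Geodominates G x y′ u
    climb f {u} {y} {k} M≤f+k D p u∈p with ∂? y
    ... | yes ∂y = y , ∈-subset⁺ ∂? ∂y , _ , D , p , u∈p
    ... | no ¬∂y with farther-neighbour ¬∂y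
    ...   | w , e , dy<dw = extend f M≤f+k
      where
      k<dw : k < d w
      k<dw = subst (_< d w) (Dist-unique (d-Dist y) D) dy<dw

      extend : ∀ f → M ≤ f + k → ∃ λ y′ → y′ ∈ ∂ × Geodominates G x y′ u
      extend zero    M≤k = contradiction (<-≤-trans k<dw (≤-trans (d≤M w) M≤k)) (n≮n _)
      extend (suc f) M≤1+f+k =
        climb f (subst (M ≤_) (sym (+-suc f k)) M≤1+f+k) (geodesic-▷ D e k<dw) (p ▷ e) (onWalk-▷ e u∈p)

    ∂-IsGeodominating : IsGeodominating G x ∂
    ∂-IsGeodominating u = climb M (m≤m+n M (d u)) (d-Dist u) (proj₁ (d-Dist u)) (onWalk-end _)

corollary1 : ∀ {n} (G : Graph n) → Connected G → (x : Fin n) →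
  Σ (Subset n) λ B →
    IsBoundary G x B ×
    IsGxSet G x B ×
    (∀ S → IsGxSet G x S → S ≡ B) ×
    IsGxNumber G x ∣ B ∣
corollary1 G connected x =
  ∂ , ∂-IsBoundary , (∂-IsGeodominating , minimum) , unique ,
  ((∂ , ∂-IsGeodominating , refl) , minimum)
  where
  open Boundary G connected x

  ∂⊆ : ∀ {S} → IsGeodominating G x S → ∂ ⊆ S
  ∂⊆ = boundary⊆geodominating G ∂-IsBoundary

  minimum : ∀ T → IsGeodominating G x T → ∣ ∂ ∣ ≤ ∣ T ∣
  minimum _ = p⊆q⇒∣p∣≤∣q∣ ∘ ∂⊆

  unique : ∀ S → IsGxSet G x S → S ≡ ∂
  unique S (geoS , minS) = ⊆∧∣∣≤⇒≡ (∂⊆ geoS) (minS ∂ ∂-IsGeodominating)
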